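{- Let $\mathfrak{A}=\langle A,\sqcap,-,0,f\rangle$ be a normal and unit-preserving Boolean frame with at least $8$ elements such that for every $a\in A$ with $a\neq0$ there is a natural number $k$ with $f^k(a)=1$. Then every Boolean frame $\mathfrak{A}^\sharp$ obtained from $\mathfrak{A}$ by the construction below is simple and does not have the congruence extension property.
   Context: A Boolean frame is an algebra $\langle A,\sqcap,-,0,f\rangle$ with $\langle A,\sqcap,-,0\rangle$ a Boolean algebra and $f:A\to A$ an arbitrary unary operation; it is normal if $f(0)=0$ and unit-preserving if $f(1)=1$; $f^k$ is the $k$-fold iterate. Construction of $\mathfrak{A}^\sharp$ (for $\mathfrak{A}$ normal, unit-preserving, with at least 8 elements): its Boolean reduct is the direct product of two copies of the Boolean reduct of $\mathfrak{A}$ (universe $A\times A$), and its operation $f^\sharp$ satisfies $f^\sharp(\langle a,0\rangle)=\langle f(a),0\rangle$, $f^\sharp(\langle0,a\rangle)=\langle0,f(a)\rangle$, $f^\sharp(\langle a,1\rangle)=\langle -f(-a),1\rangle$, $f^\sharp(\langle1,a\rangle)=\langle1,-f(-a)\rangle$ for all $a\in A$; and for $0<a<1$, $0<b<1$, $f^\sharp(\langle a,b\rangle)\in\{\langle0,0\rangle,\langle1,1\rangle\}$, chosen arbitrarily subject to: (i) $f^\sharp(\langle -a,-b\rangle)=-f^\sharp(\langle a,b\rangle)$; (ii) for every $0<x<1$ there are $0<y_1,y_2<1$ with $f^\sharp(\langle x,y_1\rangle)=\langle0,0\rangle$ and $f^\sharp(\langle x,y_2\rangle)=\langle1,1\rangle$,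 and for every $0<y<1$ there are $0<x_1,x_2<1$ with $f^\sharp(\langle x_1,y\rangle)=\langle0,0\rangle$ and $f^\sharp(\langle x_2,y\rangle)=\langle1,1\rangle$. An algebra is simple if it has exactly two congruences. An algebra has the congruence extension property if for every subalgebra $B$ and every congruence $\Theta$ of $B$ there is a congruence $\Psi$ of the algebra with $\Psi\cap(B\times B)=\Theta$. -}

module Defs where

open import Level using (0ℓ)
open import Data.Nat.Base using (ℕ; zero; suc)
open import Data.Fin.Base using (Fin)
open import Data.Product.Base using (Σ; ∃; _×_; _,_; proj₁; proj₂)
open import Data.Sum.Base using (_⊎_)
open import Function.Definitions using (Injective)
open import Relation.Nullary using (¬_)
open import Relation.Binary.PropositionalEquality using (_≡_; _≢_)
open import Algebra.Core using (Op₁; Op₂)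
open import Algebra.Lattice.Structures using (IsBooleanAlgebra)

-- Algebras of the signature ⟨ ⊓ , - , 0 , f ⟩ (operations only).
-- Congruences, subalgebras, simplicity and the CEP only depend on the
-- operations, so they are defined for such raw algebras.

record RawFrame : Set₁ where
  field
    Carrier : Set
    _⊓_     : Op₂ Carrier
    -_      : Op₁ Carrier
    𝟘       : Carrier
    f       : Op₁ Carrier

-- The stdlib structure also
-- carries ⊔ and 1, which are determined by ⊓, -, 0 via the axioms.
record BooleanFrame : Set₁ where
  field
    Carrier : Set
    _⊔_     : Op₂ Carrier
    _⊓_     : Op₂ Carrier
    -_      : Op₁ Carrier
    𝟙       : Carrier
    𝟘       : Carrier
    isBooleanAlgebra : IsBooleanAlgebra _≡_ _⊔_ _⊓_ -_ 𝟙 𝟘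
    f       : Op₁ Carrier

  raw : RawFrame
  raw = record { Carrier = Carrier ; _⊓_ = _⊓_ ; -_ = -_ ; 𝟘 = 𝟘 ; f = f }

iter : {A : Set} → (A → A) → ℕ → A → A
iter g zero    a = a
iter g (suc k) a = g (iter g k a)

module _ (𝔄 : BooleanFrame) where
  open BooleanFrame 𝔄

  IsNormal : Set
  IsNormal = f 𝟘 ≡ 𝟘

  IsUnitPreserving : Set
  IsUnitPreserving = f 𝟙 ≡ 𝟙

  AtLeast8 : Set
  AtLeast8 = Σ (Fin 8 → Carrier) Injective′
    where Injective′ : (Fin 8 → Carrier) → Set
          Injective′ g = Injective _≡_ _≡_ g

  EventuallyUnit : Set
  EventuallyUnit = ∀ a → a ≢ 𝟘 → ∃ λ k → iter f k a ≡ 𝟙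

module _ (𝔅 : RawFrame) where
  open RawFrame 𝔅

  Relation : Set₁
  Relation = Carrier → Carrier → Set

  record IsCongruence (Θ : Relation) : Set where
    field
      refl′  : ∀ x → Θ x x
      sym′   : ∀ {x y} → Θ x y → Θ y x
      trans′ : ∀ {x y z} → Θ x y → Θ y z → Θ x z
      ⊓-cong : ∀ {x y u v} → Θ x y → Θ u v → Θ (x ⊓ u) (y ⊓ v)
      neg-cong : ∀ {x y} → Θ x y → Θ (- x) (- y)
      f-cong : ∀ {x y} → Θ x y → Θ (f x) (f y)

  _≐_ : Relation → Relation → Set
  Θ ≐ Ψ = ∀ x y → (Θ x y → Ψ x y) × (Ψ x y → Θ x y)

  IsSimple : Set₁
  IsSimple =
    Σ Relation λ Θ₁ → Σ Relation λ Θ₂ →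
      IsCongruence Θ₁ × IsCongruence Θ₂ × ¬ (Θ₁ ≐ Θ₂) ×
      (∀ Θ → IsCongruence Θ → (Θ ≐ Θ₁) ⊎ (Θ ≐ Θ₂))

  record IsSubalgebra (B : Carrier → Set) : Set where
    field
      𝟘∈  : B 𝟘
      ⊓∈  : ∀ {x y} → B x → B y → B (x ⊓ y)
      -∈  : ∀ {x} → B x → B (- x)
      f∈  : ∀ {x} → B x → B (f x)

  -- a congruence of the subalgebra B, given as a relation on the elements
  -- of B (its values outside B × B are irrelevant)
  record IsCongruenceOn (B : Carrier → Set) (Θ : Relation) : Set where
    field
      refl′  : ∀ {x} → B x → Θ x x
      sym′   : ∀ {x y} → B x → B y → Θ x y → Θ y x
      trans′ : ∀ {x y z} → B x → B y → B z → Θ x y → Θ y z → Θ x z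
      ⊓-cong : ∀ {x y u v} → B x → B y → B u → B v →
               Θ x y → Θ u v → Θ (x ⊓ u) (y ⊓ v)
      neg-cong : ∀ {x y} → B x → B y → Θ x y → Θ (- x) (- y)
      f-cong : ∀ {x y} → B x → B y → Θ x y → Θ (f x) (f y)

  HasCEP : Set₁
  HasCEP = ∀ (B : Carrier → Set) → IsSubalgebra B →
           ∀ (Θ : Relation) → IsCongruenceOn B Θ →
           Σ Relation λ Ψ → IsCongruence Ψ ×
             (∀ x y → B x → B y → (Ψ x y → Θ x y) × (Θ x y → Ψ x y))

module _ (𝔄 : BooleanFrame) where
  open BooleanFrame 𝔄

  sharp : (Carrier × Carrier → Carrier × Carrier) → RawFrame
  sharp f♯ = record
    { Carrier = Carrier × Carrier
    ; _⊓_ = λ p q → (proj₁ p ⊓ proj₁ q , proj₂ p ⊓ proj₂ q)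
    ; -_  = λ p → (- proj₁ p , - proj₂ p)
    ; 𝟘   = (𝟘 , 𝟘)
    ; f   = f♯
    }

  Proper : Carrier → Set
  Proper a = (a ≢ 𝟘) × (a ≢ 𝟙)

  record IsSharpOp (f♯ : Carrier × Carrier → Carrier × Carrier) : Set where
    field
      on-a0 : ∀ a → f♯ (a , 𝟘) ≡ (f a , 𝟘)
      on-0a : ∀ a → f♯ (𝟘 , a) ≡ (𝟘 , f a)
      on-a1 : ∀ a → f♯ (a , 𝟙) ≡ (- f (- a) , 𝟙)
      on-1a : ∀ a → f♯ (𝟙 , a) ≡ (𝟙 , - f (- a))
      proper-values : ∀ a b → Proper a → Proper b →
        (f♯ (a , b) ≡ (𝟘 , 𝟘)) ⊎ (f♯ (a , b) ≡ (𝟙 , 𝟙))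
      cond-i : ∀ a b → Proper a → Proper b →
        f♯ (- a , - b) ≡ (- proj₁ (f♯ (a , b)) , - proj₂ (f♯ (a , b)))
      cond-ii-row : ∀ x → Proper x →
        (∃ λ y₁ → Proper y₁ × f♯ (x , y₁) ≡ (𝟘 , 𝟘)) ×
        (∃ λ y₂ → Proper y₂ × f♯ (x , y₂) ≡ (𝟙 , 𝟙))
      cond-ii-col : ∀ y → Proper y →
        (∃ λ x₁ → Proper x₁ × f♯ (x₁ , y) ≡ (𝟘 , 𝟘)) ×
        (∃ λ x₂ → Proper x₂ × f♯ (x₂ , y) ≡ (𝟙 , 𝟙))

{-# OPTIONS --safe #-}
module Submission where

-- If a congruence Ψ of 𝔄♯ relates two distinct pairs, meeting with a suitable
-- element gives Ψ (d , 𝟘) (𝟘 , 𝟘) for some d ≠ 𝟘, or the mirror image, which is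
-- the same case for the coordinate-swapped algebra (again an instance of the
-- construction).  As f♯ acts as f on A × {𝟘} and f 𝟘 = 𝟘, iterating gives
-- Ψ (𝟙 , 𝟘) (𝟘 , 𝟘).  Then Ψ relates any two pairs with the same second
-- coordinate, in particular the pairs (x₁ , b) and (x₂ , b) of condition (ii)
-- that f♯ sends to (𝟘 , 𝟘) and (𝟙 , 𝟙); so Ψ is total and 𝔄♯ is simple.
-- On the subalgebra A × {𝟘 , 𝟙} the operation f♯ keeps the second coordinate,
-- so having the same second coordinate is a congruence there.  It relates
-- (𝟙 , 𝟘) to (𝟘 , 𝟘), hence any extension of it is total, yet it separates
-- (𝟘 , 𝟘) from (𝟘 , 𝟙).

open import Defs
open import Level using (0ℓ)
open import Data.Product.Base using (_×_)
open import Relation.Nullary using (¬_)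
open import Axiom.ExcludedMiddle using (ExcludedMiddle)
open import Relation.Binary.PropositionalEquality using (_≡_)

open import Algebra.Lattice.Bundles using (BooleanAlgebra)
import Algebra.Lattice.Properties.BooleanAlgebra as BooleanAlgebraProperties
open import Data.Empty using (⊥-elim)
open import Data.Fin.Base using (Fin)
import Data.Fin.Base as Fin
open import Data.Nat.Base using (zero; suc; _+_)
open import Data.Product.Base using (∃; ∃₂; _,_; proj₁; proj₂; map₂; swap)
open import Data.Sum.Base using (_⊎_; inj₁; inj₂)
import Data.Sum.Base as Sum
open import Function.Base using (_∘_; _on_)
open import Function.Definitions using (Injective)
open import Relation.Nullary using (yes; no)
open import Relation.Nullary.Decidable using (decidable-stable)
open import Relation.Binary.Construct.Always using (Always)
open import Relation.Binary.PropositionalEquality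
  using (_≢_; refl; sym; trans; cong; cong₂; subst; subst₂)
import Relation.Binary.Reasoning.Setoid as SetoidReasoning

module _ {c ℓ} (𝔹 : BooleanAlgebra c ℓ) where
  open BooleanAlgebra 𝔹 renaming (¬_ to -_)
  open BooleanAlgebraProperties 𝔹 using (∧-identityʳ; ∨-identityʳ; ∧-zeroʳ)
  open SetoidReasoning setoid

  ∧-¬≈⊥⇒≈∧ : ∀ {x y} → x ∧ - y ≈ ⊥ → x ≈ x ∧ y
  ∧-¬≈⊥⇒≈∧ {x} {y} x∧¬y≈⊥ = begin
    x                ≈⟨ ∧-identityʳ x ⟨
    x ∧ ⊤            ≈⟨ ∧-congˡ (∨-complementʳ y) ⟨
    x ∧ (y ∨ - y)    ≈⟨ ∧-distribˡ-∨ x y (- y) ⟩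
    x ∧ y ∨ x ∧ - y  ≈⟨ ∨-congˡ x∧¬y≈⊥ ⟩
    x ∧ y ∨ ⊥        ≈⟨ ∨-identityʳ (x ∧ y) ⟩
    x ∧ y            ∎

  ∧-¬≈⊥-antisym : ∀ {x y} → x ∧ - y ≈ ⊥ → y ∧ - x ≈ ⊥ → x ≈ y
  ∧-¬≈⊥-antisym {x} {y} x∧¬y≈⊥ y∧¬x≈⊥ = begin
    x      ≈⟨ ∧-¬≈⊥⇒≈∧ x∧¬y≈⊥ ⟩
    x ∧ y  ≈⟨ ∧-comm x y ⟩
    y ∧ x  ≈⟨ ∧-¬≈⊥⇒≈∧ y∧¬x≈⊥ ⟨
    y      ∎

  ⊥≈⊤⇒≈⊥ : ⊥ ≈ ⊤ → ∀ x → x ≈ ⊥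
  ⊥≈⊤⇒≈⊥ ⊥≈⊤ x = begin
    x      ≈⟨ ∧-identityʳ x ⟨
    x ∧ ⊤  ≈⟨ ∧-congˡ ⊥≈⊤ ⟨
    x ∧ ⊥  ≈⟨ ∧-zeroʳ x ⟩
    ⊥      ∎

module _ (em : ExcludedMiddle 0ℓ) {A : Set} {n} (g : Fin (3 + n) → A)
         (g-injective : Injective _≡_ _≡_ g) where

  private
    apart : ∀ {i j w} → g i ≡ w → i ≢ j → g j ≢ w
    apart gᵢ≡w i≢j gⱼ≡w = i≢j (g-injective (trans gᵢ≡w (sym gⱼ≡w)))

    avoid-if-first : ∀ {u} v → g Fin.zero ≡ u → ∃ λ a → a ≢ u × a ≢ v
    avoid-if-first v g₀≡u with em {g (Fin.suc Fin.zero) ≡ v}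
    ... | no g₁≢v  = g (Fin.suc Fin.zero) , apart g₀≡u (λ ()) , g₁≢v
    ... | yes g₁≡v = g (Fin.suc (Fin.suc Fin.zero)) , apart g₀≡u (λ ()) , apart g₁≡v (λ ())

  ∃≢both : ∀ u v → ∃ λ a → a ≢ u × a ≢ v
  ∃≢both u v with em {g Fin.zero ≡ u} | em {g Fin.zero ≡ v}
  ... | yes g₀≡u | _        = avoid-if-first v g₀≡u
  ... | _        | yes g₀≡v = map₂ swap (avoid-if-first u g₀≡v)
  ... | no g₀≢u  | no g₀≢v  = g Fin.zero , g₀≢u , g₀≢v

module _ (𝔅 : RawFrame) where
  open RawFrame 𝔅

  ≡-isCongruence : IsCongruence 𝔅 _≡_
  ≡-isCongruence = record
    { refl′ = λ _ → refl ; sym′ = sym ; trans′ = trans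
    ; ⊓-cong = cong₂ _⊓_ ; neg-cong = cong -_ ; f-cong = cong f }

  Always-isCongruence : IsCongruence 𝔅 Always
  Always-isCongruence = record
    { refl′ = λ _ → _ ; sym′ = λ _ → _ ; trans′ = λ _ _ → _
    ; ⊓-cong = λ _ _ → _ ; neg-cong = λ _ → _ ; f-cong = λ _ → _ }

  isSimple-if-relating-distinct⇒total : ExcludedMiddle 0ℓ → {u v : Carrier} → u ≢ v →
    (∀ {Ψ} → IsCongruence 𝔅 Ψ → ∀ {p q} → p ≢ q → Ψ p q → ∀ x y → Ψ x y) →
    IsSimple 𝔅
  isSimple-if-relating-distinct⇒total em {u} {v} u≢v distinct⇒total =
    _≡_ , Always , ≡-isCongruence , Always-isCongruence , ≡≭Always , classify
    where
    ≡≭Always : ¬ (_≐_ 𝔅 _≡_ Always)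
    ≡≭Always same = u≢v (proj₂ (same u v) _)

    classify : ∀ Θ → IsCongruence 𝔅 Θ → _≐_ 𝔅 Θ _≡_ ⊎ _≐_ 𝔅 Θ Always
    classify Θ Θ-cong with em {∃₂ λ p q → Θ p q × p ≢ q}
    ... | yes (p , q , Θpq , p≢q) =
      inj₂ λ x y → (λ _ → _) , (λ _ → distinct⇒total Θ-cong p≢q Θpq x y)
    ... | no ∄distinct = inj₁ λ x y →
      (λ Θxy → decidable-stable em λ x≢y → ∄distinct (x , y , Θxy , x≢y)) ,
      (λ { refl → IsCongruence.refl′ Θ-cong x })

module _ (𝔄 : BooleanFrame) where
  open BooleanFrame 𝔄

  booleanAlgebra : BooleanAlgebra 0ℓ 0ℓ
  booleanAlgebra = record { isBooleanAlgebra = isBooleanAlgebra }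

  open BooleanAlgebra booleanAlgebra using (∧-complementʳ)
  open BooleanAlgebraProperties booleanAlgebra
    using (∧-identityʳ; ∧-identityˡ; ∧-zeroʳ; ∧-zeroˡ; ¬⊥≈⊤; ¬⊤≈⊥)

  𝟘≢𝟙 : ∀ {a} → a ≢ 𝟘 → 𝟘 ≢ 𝟙
  𝟘≢𝟙 {a} a≢𝟘 𝟘≡𝟙 = a≢𝟘 (⊥≈⊤⇒≈⊥ booleanAlgebra 𝟘≡𝟙 a)

  ≢⇒⊓-≢𝟘 : ExcludedMiddle 0ℓ → ∀ {x y} → x ≢ y → x ⊓ (- y) ≢ 𝟘 ⊎ y ⊓ (- x) ≢ 𝟘
  ≢⇒⊓-≢𝟘 em {x} {y} x≢y with em {x ⊓ (- y) ≡ 𝟘} | em {y ⊓ (- x) ≡ 𝟘}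
  ... | no x⊓-y≢𝟘 | _            = inj₁ x⊓-y≢𝟘
  ... | yes _      | no y⊓-x≢𝟘   = inj₂ y⊓-x≢𝟘
  ... | yes x⊓-y≡𝟘 | yes y⊓-x≡𝟘 = ⊥-elim (x≢y (∧-¬≈⊥-antisym booleanAlgebra x⊓-y≡𝟘 y⊓-x≡𝟘))

  module _ {f♯ : Carrier × Carrier → Carrier × Carrier} where

    swap-IsSharpOp : IsSharpOp 𝔄 f♯ → IsSharpOp 𝔄 (swap ∘ f♯ ∘ swap)
    swap-IsSharpOp S = record
      { on-a0 = cong swap ∘ on-0a
      ; on-0a = cong swap ∘ on-a0
      ; on-a1 = cong swap ∘ on-1a
      ; on-1a = cong swap ∘ on-a1
      ; proper-values = λ a b a-proper b-proper →
          Sum.map (cong swap) (cong swap) (proper-values b a b-proper a-proper)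
      ; cond-i = λ a b a-proper b-proper → cong swap (cond-i b a b-proper a-proper)
      ; cond-ii-row = λ x x-proper → swap-witnesses (cond-ii-col x x-proper)
      ; cond-ii-col = λ y y-proper → swap-witnesses (cond-ii-row y y-proper)
      }
      where
      open IsSharpOp S

      TakesBothValues : (Carrier → Carrier × Carrier) → Set
      TakesBothValues g = (∃ λ y → Proper 𝔄 y × g y ≡ (𝟘 , 𝟘)) ×
                          (∃ λ y → Proper 𝔄 y × g y ≡ (𝟙 , 𝟙))

      swap-witnesses : ∀ {g} → TakesBothValues g → TakesBothValues (swap ∘ g)
      swap-witnesses ((y₁ , y₁-proper , g₁≡𝟘) , (y₂ , y₂-proper , g₂≡𝟙)) =
        (y₁ , y₁-proper , cong swap g₁≡𝟘) , (y₂ , y₂-proper , cong swap g₂≡𝟙)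

    swap-IsCongruence : ∀ {Ψ} → IsCongruence (sharp 𝔄 f♯) Ψ →
                        IsCongruence (sharp 𝔄 (swap ∘ f♯ ∘ swap)) (Ψ on swap)
    swap-IsCongruence Ψ-cong = record
      { refl′ = refl′ ∘ swap ; sym′ = sym′ ; trans′ = trans′
      ; ⊓-cong = ⊓-cong ; neg-cong = neg-cong ; f-cong = f-cong }
      where open IsCongruence Ψ-cong

  module _ {f♯ : Carrier × Carrier → Carrier × Carrier}
           {Ψ} (Ψ-cong : IsCongruence (sharp 𝔄 f♯) Ψ) where
    open IsCongruence Ψ-cong

    relates-𝟘𝟙⇒total : Ψ (𝟘 , 𝟘) (𝟙 , 𝟙) → ∀ p q → Ψ p q
    relates-𝟘𝟙⇒total Ψ𝟘𝟙 p q = trans′ (to-𝟘 p) (sym′ (to-𝟘 q))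
      where
      to-𝟘 : ∀ p → Ψ p (𝟘 , 𝟘)
      to-𝟘 (a , b) = subst₂ Ψ (cong₂ _,_ (∧-identityʳ a) (∧-identityʳ b))
                              (cong₂ _,_ (∧-zeroʳ a) (∧-zeroʳ b))
                              (⊓-cong (refl′ (a , b)) (sym′ Ψ𝟘𝟙))

    relates-𝟙𝟘⇒relates-same-second : Ψ (𝟙 , 𝟘) (𝟘 , 𝟘) → ∀ x x' y → Ψ (x , y) (x' , y)
    relates-𝟙𝟘⇒relates-same-second Ψ𝟙𝟘 x x' y = trans′ (sym′ (to-𝟘 x)) (to-𝟘 x')
      where
      Ψ𝟘𝟙 : Ψ (𝟘 , 𝟙) (𝟙 , 𝟙)
      Ψ𝟘𝟙 = subst₂ Ψ (cong₂ _,_ ¬⊤≈⊥ ¬⊥≈⊤) (cong₂ _,_ ¬⊥≈⊤ ¬⊥≈⊤) (neg-cong Ψ𝟙𝟘)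

      to-𝟘 : ∀ x → Ψ (𝟘 , y) (x , y)
      to-𝟘 x = subst₂ Ψ (cong₂ _,_ (∧-zeroˡ x) (∧-identityˡ y))
                        (cong₂ _,_ (∧-identityˡ x) (∧-identityˡ y))
                        (⊓-cong Ψ𝟘𝟙 (refl′ (x , y)))

    relates⇒relates-difference-𝟘 : ∀ {x y x' y'} → Ψ (x , y) (x' , y') →
                                   Ψ (x ⊓ (- x') , 𝟘) (𝟘 , 𝟘)
    relates⇒relates-difference-𝟘 {x} {y} {x'} {y'} Ψpq =
      subst₂ Ψ (cong (x ⊓ (- x') ,_) (∧-zeroʳ y))
               (cong₂ _,_ (∧-complementʳ x') (∧-zeroʳ y'))
               (⊓-cong Ψpq (refl′ (- x' , 𝟘)))

  module _ {f♯ : Carrier × Carrier → Carrier × Carrier} (S : IsSharpOp 𝔄 f♯)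
           {Ψ} (Ψ-cong : IsCongruence (sharp 𝔄 f♯) Ψ) where
    open IsSharpOp S
    open IsCongruence Ψ-cong

    relates-𝟙𝟘⇒relates-𝟘𝟙 : ∀ {b} → Proper 𝔄 b → Ψ (𝟙 , 𝟘) (𝟘 , 𝟘) → Ψ (𝟘 , 𝟘) (𝟙 , 𝟙)
    relates-𝟙𝟘⇒relates-𝟘𝟙 {b} b-proper Ψ𝟙𝟘 with cond-ii-col b b-proper
    ... | (x₁ , _ , f♯x₁b≡𝟘) , (x₂ , _ , f♯x₂b≡𝟙) =
      subst₂ Ψ f♯x₁b≡𝟘 f♯x₂b≡𝟙
        (f-cong (relates-𝟙𝟘⇒relates-same-second Ψ-cong Ψ𝟙𝟘 x₁ x₂ b))

    relates-𝟘⇒relates-iter-𝟘 : IsNormal 𝔄 → ∀ {d} k →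
                               Ψ (d , 𝟘) (𝟘 , 𝟘) → Ψ (iter f k d , 𝟘) (𝟘 , 𝟘)
    relates-𝟘⇒relates-iter-𝟘 normal zero    Ψd𝟘 = Ψd𝟘
    relates-𝟘⇒relates-iter-𝟘 normal (suc k) Ψd𝟘 =
      subst₂ Ψ (on-a0 _) (trans (on-a0 𝟘) (cong (_, 𝟘) normal))
        (f-cong (relates-𝟘⇒relates-iter-𝟘 normal k Ψd𝟘))

  module _ (em : ExcludedMiddle 0ℓ) (normal : IsNormal 𝔄) (eventually-unit : EventuallyUnit 𝔄)
           {b} (b-proper : Proper 𝔄 b) where

    relates-nonzero-𝟘⇒relates-𝟘𝟙 :
      ∀ {f♯} → IsSharpOp 𝔄 f♯ → ∀ {Ψ} → IsCongruence (sharp 𝔄 f♯) Ψ →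
      ∀ {d} → d ≢ 𝟘 → Ψ (d , 𝟘) (𝟘 , 𝟘) → Ψ (𝟘 , 𝟘) (𝟙 , 𝟙)
    relates-nonzero-𝟘⇒relates-𝟘𝟙 S {Ψ} Ψ-cong d≢𝟘 Ψd𝟘 with eventually-unit _ d≢𝟘
    ... | k , fᵏd≡𝟙 = relates-𝟙𝟘⇒relates-𝟘𝟙 S Ψ-cong b-proper
      (subst (λ a → Ψ (a , 𝟘) (𝟘 , 𝟘)) fᵏd≡𝟙
             (relates-𝟘⇒relates-iter-𝟘 S Ψ-cong normal k Ψd𝟘))

    relates-distinct-first⇒relates-𝟘𝟙 :
      ∀ {f♯} → IsSharpOp 𝔄 f♯ → ∀ {Ψ} → IsCongruence (sharp 𝔄 f♯) Ψ →
      ∀ {x y x' y'} → x ≢ x' → Ψ (x , y) (x' , y') → Ψ (𝟘 , 𝟘) (𝟙 , 𝟙)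
    relates-distinct-first⇒relates-𝟘𝟙 S Ψ-cong x≢x' Ψpq with ≢⇒⊓-≢𝟘 em x≢x'
    ... | inj₁ d≢𝟘 = relates-nonzero-𝟘⇒relates-𝟘𝟙 S Ψ-cong d≢𝟘
                       (relates⇒relates-difference-𝟘 Ψ-cong Ψpq)
    ... | inj₂ d≢𝟘 = relates-nonzero-𝟘⇒relates-𝟘𝟙 S Ψ-cong d≢𝟘
                       (relates⇒relates-difference-𝟘 Ψ-cong (IsCongruence.sym′ Ψ-cong Ψpq))

    relates-distinct⇒relates-𝟘𝟙 :
      ∀ {f♯} → IsSharpOp 𝔄 f♯ → ∀ {Ψ} → IsCongruence (sharp 𝔄 f♯) Ψ →
      ∀ {p q} → p ≢ q → Ψ p q → Ψ (𝟘 , 𝟘) (𝟙 , 𝟙)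
    relates-distinct⇒relates-𝟘𝟙 S Ψ-cong {x , y} {x' , y'} p≢q Ψpq with em {x ≡ x'}
    ... | no x≢x'  = relates-distinct-first⇒relates-𝟘𝟙 S Ψ-cong x≢x' Ψpq
    ... | yes refl = relates-distinct-first⇒relates-𝟘𝟙
                       (swap-IsSharpOp S) (swap-IsCongruence Ψ-cong) (p≢q ∘ cong (x ,_)) Ψpq

    sharp-isSimple : ∀ {f♯} → IsSharpOp 𝔄 f♯ → IsSimple (sharp 𝔄 f♯)
    sharp-isSimple S = isSimple-if-relating-distinct⇒total _ em {𝟘 , 𝟘} {𝟙 , 𝟙}
      (𝟘≢𝟙 (proj₁ b-proper) ∘ cong proj₁)
      λ Ψ-cong p≢q Ψpq → relates-𝟘𝟙⇒total Ψ-cong (relates-distinct⇒relates-𝟘𝟙 S Ψ-cong p≢q Ψpq)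

  Is𝟘or𝟙 : Carrier → Set
  Is𝟘or𝟙 y = y ≡ 𝟘 ⊎ y ≡ 𝟙

  SameSecond : Carrier × Carrier → Carrier × Carrier → Set
  SameSecond p q = proj₂ p ≡ proj₂ q

  module _ {f♯ : Carrier × Carrier → Carrier × Carrier} (S : IsSharpOp 𝔄 f♯) where
    open IsSharpOp S

    f♯-preserves-second-𝟘or𝟙 : ∀ {p} → Is𝟘or𝟙 (proj₂ p) → proj₂ (f♯ p) ≡ proj₂ p
    f♯-preserves-second-𝟘or𝟙 {a , _} (inj₁ refl) = cong proj₂ (on-a0 a)
    f♯-preserves-second-𝟘or𝟙 {a , _} (inj₂ refl) = cong proj₂ (on-a1 a)

    second-𝟘or𝟙-isSubalgebra : IsSubalgebra (sharp 𝔄 f♯) (Is𝟘or𝟙 ∘ proj₂)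
    second-𝟘or𝟙-isSubalgebra = record
      { 𝟘∈ = inj₁ refl
      ; ⊓∈ = ⊓-closed
      ; -∈ = λ { (inj₁ refl) → inj₂ ¬⊥≈⊤ ; (inj₂ refl) → inj₁ ¬⊤≈⊥ }
      ; f∈ = λ p∈ → subst Is𝟘or𝟙 (sym (f♯-preserves-second-𝟘or𝟙 p∈)) p∈
      }
      where
      ⊓-closed : ∀ {y y'} → Is𝟘or𝟙 y → Is𝟘or𝟙 y' → Is𝟘or𝟙 (y ⊓ y')
      ⊓-closed {y' = y'} (inj₁ refl) _   = inj₁ (∧-zeroˡ y')
      ⊓-closed {y' = y'} (inj₂ refl) y'∈ = subst Is𝟘or𝟙 (sym (∧-identityˡ y')) y'∈

    SameSecond-isCongruenceOn : IsCongruenceOn (sharp 𝔄 f♯) (Is𝟘or𝟙 ∘ proj₂) SameSecond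
    SameSecond-isCongruenceOn = record
      { refl′ = λ _ → refl ; sym′ = λ _ _ → sym ; trans′ = λ _ _ _ → trans
      ; ⊓-cong = λ _ _ _ _ → cong₂ _⊓_ ; neg-cong = λ _ _ → cong -_
      ; f-cong = λ p∈ q∈ p₂≡q₂ → trans (f♯-preserves-second-𝟘or𝟙 p∈)
                                   (trans p₂≡q₂ (sym (f♯-preserves-second-𝟘or𝟙 q∈)))
      }

    sharp-¬HasCEP : ∀ {b} → Proper 𝔄 b → ¬ HasCEP (sharp 𝔄 f♯)
    sharp-¬HasCEP b-proper cep
      with cep _ second-𝟘or𝟙-isSubalgebra SameSecond SameSecond-isCongruenceOn
    ... | Ψ , Ψ-cong , restricts-to =
      𝟘≢𝟙 (proj₁ b-proper) (proj₁ (restricts-to (𝟘 , 𝟘) (𝟘 , 𝟙) (inj₁ refl) (inj₂ refl)) Ψ𝟘𝟘𝟘𝟙)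
      where
      Ψ𝟙𝟘 : Ψ (𝟙 , 𝟘) (𝟘 , 𝟘)
      Ψ𝟙𝟘 = proj₂ (restricts-to (𝟙 , 𝟘) (𝟘 , 𝟘) (inj₁ refl) (inj₁ refl)) refl

      Ψ𝟘𝟘𝟘𝟙 : Ψ (𝟘 , 𝟘) (𝟘 , 𝟙)
      Ψ𝟘𝟘𝟘𝟙 = relates-𝟘𝟙⇒total Ψ-cong (relates-𝟙𝟘⇒relates-𝟘𝟙 S Ψ-cong b-proper Ψ𝟙𝟘) _ _

lemma2p17 : ExcludedMiddle 0ℓ → (𝔄 : BooleanFrame) →
    IsNormal 𝔄 → IsUnitPreserving 𝔄 → AtLeast8 𝔄 → EventuallyUnit 𝔄 →
    (f♯ : BooleanFrame.Carrier 𝔄 × BooleanFrame.Carrier 𝔄 →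
          BooleanFrame.Carrier 𝔄 × BooleanFrame.Carrier 𝔄) →
    IsSharpOp 𝔄 f♯ →
    IsSimple (sharp 𝔄 f♯) × ¬ HasCEP (sharp 𝔄 f♯)
lemma2p17 em 𝔄 normal _ (g , g-injective) eventually-unit f♯ S
  with ∃≢both em g g-injective (BooleanFrame.𝟘 𝔄) (BooleanFrame.𝟙 𝔄)
... | _ , b-proper =
  sharp-isSimple 𝔄 em normal eventually-unit b-proper S , sharp-¬HasCEP 𝔄 S b-proper
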